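{- Let $\mathbb{B}$ be a category with pullbacks. Suppose that the class of split epimorphisms in $\mathbb{B}$ is definable as a full notion of structure on the codomain fibration $\operatorname{cod}:\mathbb{B}^\to\to\mathbb{B}$. Then every regular epimorphism in $\mathbb{B}$ splits.
   Context: Split epimorphisms are stable under pullback. A pullback-stable class $\mathcal{D}$ of maps is definable (as a full notion of structure on $\operatorname{cod}$) if the inclusion of the category whose objects are the maps in $\mathcal{D}$ and whose morphisms are pullback squares into the category of all maps of $\mathbb{B}$ with pullback squares as morphisms has a right adjoint; equivalently, for every $f:X\to Y$ there is a monomorphism $U\rightarrowtail Y$ such that for all $g:Z\to Y$, the pullback $g^\ast(f)$ lies in $\mathcal{D}$ if and only if $g$ factors through $U$. -}

module Defs where

open import Level using (Level; _⊔_; suc)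
open import Data.Product using (Σ; Σ-syntax; ∃; ∃-syntax; _×_; _,_)
open import Relation.Binary.PropositionalEquality using (_≡_)

record Category (o ℓ : Level) : Set (suc (o ⊔ ℓ)) where
  infixr 9 _∘_
  field
    Obj  : Set o
    Hom  : Obj → Obj → Set ℓ
    id   : ∀ {A} → Hom A A
    _∘_  : ∀ {A B C} → Hom B C → Hom A B → Hom A C
    identityˡ : ∀ {A B} (f : Hom A B) → id ∘ f ≡ f
    identityʳ : ∀ {A B} (f : Hom A B) → f ∘ id ≡ f
    assoc     : ∀ {A B C D} (f : Hom C D) (g : Hom B C) (h : Hom A B) →
                (f ∘ g) ∘ h ≡ f ∘ (g ∘ h)

module _ {o ℓ : Level} (𝔹 : Category o ℓ) where
  open Category 𝔹

  Mono : ∀ {U Y} → Hom U Y → Set (o ⊔ ℓ)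
  Mono {U} m = ∀ {W} (a b : Hom W U) → m ∘ a ≡ m ∘ b → a ≡ b

  SplitEpi : ∀ {X Y} → Hom X Y → Set ℓ
  SplitEpi {X} {Y} e = Σ[ s ∈ Hom Y X ] (e ∘ s ≡ id)

  IsCoequalizer : ∀ {K X Y} → Hom K X → Hom K X → Hom X Y → Set (o ⊔ ℓ)
  IsCoequalizer {K} {X} {Y} a b e =
    (e ∘ a ≡ e ∘ b) ×
    (∀ {W} (h : Hom X W) → h ∘ a ≡ h ∘ b →
       Σ[ u ∈ Hom Y W ] ((u ∘ e ≡ h) × (∀ (v : Hom Y W) → v ∘ e ≡ h → v ≡ u)))

  RegularEpi : ∀ {X Y} → Hom X Y → Set (o ⊔ ℓ)
  RegularEpi {X} e = Σ[ K ∈ Obj ] Σ[ a ∈ Hom K X ] Σ[ b ∈ Hom K X ] IsCoequalizer a b e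

  -- A pullback of f : X → Y along g : Z → Y:
  --     P --p₂--> X
  --     |p₁       | f
  --     v         v
  --     Z --g---> Y
  -- p₁ : P → Z is the pullback g*(f).
  record Pullback {X Y Z} (f : Hom X Y) (g : Hom Z Y) : Set (o ⊔ ℓ) where
    field
      P        : Obj
      p₁       : Hom P Z
      p₂       : Hom P X
      commute  : g ∘ p₁ ≡ f ∘ p₂
      universal : ∀ {W} (a : Hom W Z) (b : Hom W X) → g ∘ a ≡ f ∘ b →
        Σ[ u ∈ Hom W P ] ((p₁ ∘ u ≡ a) × (p₂ ∘ u ≡ b) ×
          (∀ (v : Hom W P) → p₁ ∘ v ≡ a → p₂ ∘ v ≡ b → v ≡ u))

  HasPullbacks : Set (o ⊔ ℓ)
  HasPullbacks = ∀ {X Y Z} (f : Hom X Y) (g : Hom Z Y) → Pullback f g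

  -- The class of split epimorphisms is definable (as a full notion of structure
  -- on cod): for every f : X → Y there is a mono m : U ↣ Y such that for all
  -- g : Z → Y, g*(f) is split epi iff g factors through m.
  SplitEpisDefinable : HasPullbacks → Set (o ⊔ ℓ)
  SplitEpisDefinable pb =
    ∀ {X Y} (f : Hom X Y) →
      Σ[ U ∈ Obj ] Σ[ m ∈ Hom U Y ] (Mono m ×
        (∀ {Z} (g : Hom Z Y) →
          (SplitEpi (Pullback.p₁ (pb f g)) → Σ[ h ∈ Hom Z U ] (m ∘ h ≡ g)) ×
          (Σ[ h ∈ Hom Z U ] (m ∘ h ≡ g) → SplitEpi (Pullback.p₁ (pb f g)))))

{-# OPTIONS --safe #-}
module Submission where

-- A pullback of e along itself always splits (by the diagonal), so the classifying
-- mono m of the definable class of split epis lets e factor as e = m ∘ h. A regular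
-- epi that factors through a mono forces that mono to be split epi, so id factors
-- through m; hence the pullback of e along id splits, and so does e itself.

open import Level using (Level)
open import Defs
open import Data.Product using (Σ-syntax; _,_; proj₁; proj₂)
open import Relation.Binary.PropositionalEquality using (_≡_; refl; sym; trans; cong; module ≡-Reasoning)

module _ {o ℓ : Level} (𝔹 : Category o ℓ) where
  open Category 𝔹
  open ≡-Reasoning

  IsCoequalizer⇒epi : ∀ {K X Y W} {a b : Hom K X} {e : Hom X Y} → IsCoequalizer 𝔹 a b e →
                      (v w : Hom Y W) → v ∘ e ≡ w ∘ e → v ≡ w
  IsCoequalizer⇒epi {a = a} {b} {e} (e∘a≡e∘b , universal) v w v∘e≡w∘e =
    trans (unique v v∘e≡w∘e) (sym (unique w refl))
    where
    w∘e-coequalizes : (w ∘ e) ∘ a ≡ (w ∘ e) ∘ b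
    w∘e-coequalizes = begin
      (w ∘ e) ∘ a ≡⟨ assoc w e a ⟩
      w ∘ (e ∘ a) ≡⟨ cong (w ∘_) e∘a≡e∘b ⟩
      w ∘ (e ∘ b) ≡⟨ sym (assoc w e b) ⟩
      (w ∘ e) ∘ b ∎
    unique = proj₂ (proj₂ (universal (w ∘ e) w∘e-coequalizes))

  IsCoequalizer∘Mono⇒SplitEpi : ∀ {K X Y U} {a b : Hom K X} {e : Hom X Y}
                                {m : Hom U Y} {h : Hom X U} →
                                IsCoequalizer 𝔹 a b e → Mono 𝔹 m → m ∘ h ≡ e → SplitEpi 𝔹 m
  IsCoequalizer∘Mono⇒SplitEpi {X = X} {Y = Y} {U = U} {a = a} {b} {e} {m} {h}
                              coeq@(e∘a≡e∘b , universal) mono m∘h≡e =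
    u , IsCoequalizer⇒epi coeq (m ∘ u) id m∘u∘e≡id∘e
    where
    m∘h∘-≡e∘- : ∀ {W} (c : Hom W X) → m ∘ (h ∘ c) ≡ e ∘ c
    m∘h∘-≡e∘- c = trans (sym (assoc m h c)) (cong (_∘ c) m∘h≡e)

    h∘a≡h∘b : h ∘ a ≡ h ∘ b
    h∘a≡h∘b = mono (h ∘ a) (h ∘ b)
      (trans (m∘h∘-≡e∘- a) (trans e∘a≡e∘b (sym (m∘h∘-≡e∘- b))))

    u : Hom Y U
    u = proj₁ (universal h h∘a≡h∘b)

    m∘u∘e≡id∘e : (m ∘ u) ∘ e ≡ id ∘ e
    m∘u∘e≡id∘e = begin
      (m ∘ u) ∘ e ≡⟨ assoc m u e ⟩
      m ∘ (u ∘ e) ≡⟨ cong (m ∘_) (proj₁ (proj₂ (universal h h∘a≡h∘b))) ⟩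
      m ∘ h       ≡⟨ m∘h≡e ⟩
      e           ≡⟨ sym (identityˡ e) ⟩
      id ∘ e      ∎

  Pullback-self-SplitEpi : ∀ {X Y} {f : Hom X Y} (P : Pullback 𝔹 f f) → SplitEpi 𝔹 (Pullback.p₁ P)
  Pullback-self-SplitEpi P = proj₁ diagonal , proj₁ (proj₂ diagonal)
    where diagonal = Pullback.universal P id id refl

  Pullback-SplitEpi⇒lift : ∀ {X Y Z} {f : Hom X Y} {g : Hom Z Y} (P : Pullback 𝔹 f g) →
                           SplitEpi 𝔹 (Pullback.p₁ P) → Σ[ k ∈ Hom Z X ] (f ∘ k ≡ g)
  Pullback-SplitEpi⇒lift {f = f} {g} P (s , p₁∘s≡id) = p₂ ∘ s , (begin
    f ∘ (p₂ ∘ s) ≡⟨ sym (assoc f p₂ s) ⟩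
    (f ∘ p₂) ∘ s ≡⟨ cong (_∘ s) (sym commute) ⟩
    (g ∘ p₁) ∘ s ≡⟨ assoc g p₁ s ⟩
    g ∘ (p₁ ∘ s) ≡⟨ cong (g ∘_) p₁∘s≡id ⟩
    g ∘ id       ≡⟨ identityʳ g ⟩
    g            ∎)
    where open Pullback P

  Pullback-along-id-SplitEpi⇒SplitEpi : ∀ {X Y} {f : Hom X Y} (P : Pullback 𝔹 f id) →
                                         SplitEpi 𝔹 (Pullback.p₁ P) → SplitEpi 𝔹 f
  Pullback-along-id-SplitEpi⇒SplitEpi P split = Pullback-SplitEpi⇒lift P split

mainTheorem7 : ∀ {o ℓ : Level} (𝔹 : Category o ℓ) (pb : HasPullbacks 𝔹) →
    SplitEpisDefinable 𝔹 pb →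
    ∀ {X Y : Category.Obj 𝔹} (e : Category.Hom 𝔹 X Y) →
    RegularEpi 𝔹 e → SplitEpi 𝔹 e
mainTheorem7 𝔹 pb definable e (_ , _ , _ , coequalizer) =
  Pullback-along-id-SplitEpi⇒SplitEpi 𝔹 (pb e id) (proj₂ (classifies id) id-through-m)
  where
  open Category 𝔹
  classifier = definable e
  m          = proj₁ (proj₂ classifier)
  mono       = proj₁ (proj₂ (proj₂ classifier))
  classifies = proj₂ (proj₂ (proj₂ classifier))

  e-through-m : Σ[ h ∈ Hom _ _ ] (m ∘ h ≡ e)
  e-through-m = proj₁ (classifies e) (Pullback-self-SplitEpi 𝔹 (pb e e))

  id-through-m : SplitEpi 𝔹 m
  id-through-m = IsCoequalizer∘Mono⇒SplitEpi 𝔹 coequalizer mono (proj₂ e-through-m)
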